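{- For every prime power $q$ there exist positive integers $n,k,m$ and an $[n,k]_{q^m/q}$ code which is MRD but not $2$-MRD.
   Context: An $[n,k]_{q^m/q}$ code is a $k$-dimensional $\mathbb{F}_{q^m}$-subspace $\mathcal{C}$ of $\mathbb{F}_{q^m}^n$; the rank weight of a vector is the $\mathbb{F}_q$-dimension of the $\mathbb{F}_q$-span of its entries, and $d=d_{\mathrm{rk}}(\mathcal{C})$ is the least rank weight of a nonzero codeword. $\mathcal{C}$ is MRD if $mk=\min\{m(n-d+1),n(m-d+1)\}$. Galois closed subspaces of $\mathbb{F}_{q^m}^n$ are $\mathbb{F}_{q^m}$-subspaces invariant under coordinatewise $q$-Frobenius; for $1\le s\le k$, $d_{\mathrm{rk},s}(\mathcal{C})$ is the minimum dimension of a Galois closed $\mathcal{A}$ with $\dim_{\mathbb{F}_{q^m}}(\mathcal{A}\cap\mathcal{C})\ge s$. For $1\le s\le k$, $\mathcal{C}$ is $s$-MRD if $d_{\mathrm{rk},s}(\mathcal{C})=n-k+s$. -}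

module Defs where

open import Level using (0ℓ)
open import Data.Nat as ℕ using (ℕ; zero; suc; _≤_; _∸_; _⊔_; _⊓_)
open import Data.Fin using (Fin; zero; suc)
open import Data.Product using (Σ; ∃; ∃-syntax; _×_; _,_)
open import Relation.Nullary using (¬_)
open import Relation.Binary.PropositionalEquality using (_≡_)
open import Algebra.Structures using (IsCommutativeRing)
open import Function.Bundles using (_↔_)

record Field : Set₁ where
  field
    Carrier : Set
    _+_ _*_ : Carrier → Carrier → Carrier
    -_      : Carrier → Carrier
    0# 1#   : Carrier
    isCommutativeRing : IsCommutativeRing _≡_ _+_ _*_ -_ 0# 1#
    0≢1     : ¬ (0# ≡ 1#)
    inverse : ∀ x → ¬ (x ≡ 0#) → ∃[ y ] (x * y ≡ 1#)

  infixl 6 _+_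
  infixl 7 _*_

  _^_ : Carrier → ℕ → Carrier
  x ^ zero  = 1#
  x ^ suc e = x * (x ^ e)

  sumF : ∀ k → (Fin k → Carrier) → Carrier
  sumF zero    f = 0#
  sumF (suc k) f = f zero + sumF k (λ i → f (suc i))

HasSize : Field → ℕ → Set
HasSize K q = Field.Carrier K ↔ Fin q

record Extension (K L : Field) (m : ℕ) : Set where
  private
    module K = Field K
    module L = Field L
  field
    ι      : K.Carrier → L.Carrier
    ι-+    : ∀ x y → ι (x K.+ y) ≡ ι x L.+ ι y
    ι-*    : ∀ x y → ι (x K.* y) ≡ ι x L.* ι y
    ι-1    : ι K.1# ≡ L.1#
    basis  : Fin m → L.Carrier
    coords : ∀ x → Σ (Fin m → K.Carrier) λ c → (x ≡ L.sumF m (λ i → ι (c i) L.* basis i))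
    unique : ∀ (c c' : Fin m → K.Carrier)
             → L.sumF m (λ i → ι (c i) L.* basis i)
               ≡ L.sumF m (λ i → ι (c' i) L.* basis i)
             → ∀ i → c i ≡ c' i

record VS (F : Field) : Set₁ where
  field
    V    : Set
    _≈_  : V → V → Set
    _⊕_  : V → V → V
    𝟎    : V
    _·_  : Field.Carrier F → V → V

module _ {F : Field} (W : VS F) where
  open VS W
  private module F = Field F

  lincomb : ∀ t → (Fin t → F.Carrier) → (Fin t → V) → V
  lincomb zero    c b = 𝟎
  lincomb (suc t) c b = (c zero · b zero) ⊕ lincomb t (λ i → c (suc i)) (λ i → b (suc i))

  Pred : Set₁
  Pred = V → Set

  record IsSubspace (S : Pred) : Set where
    field
      resp  : ∀ {u v} → u ≈ v → S u → S v
      has0  : S 𝟎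
      closed+ : ∀ {u v} → S u → S v → S (u ⊕ v)
      closed· : ∀ a {v} → S v → S (a · v)

  LinIndep : ∀ t → (Fin t → V) → Set
  LinIndep t b = ∀ c → lincomb t c b ≈ 𝟎 → ∀ i → c i ≡ F.0#

  Dim : Pred → ℕ → Set
  Dim S t = Σ (Fin t → V) λ b →
              (∀ i → S (b i)) × LinIndep t b ×
              (∀ v → S v → Σ (Fin t → F.Carrier) λ c → v ≈ lincomb t c b)

  DimGE : Pred → ℕ → Set
  DimGE S s = ∃[ t ] (s ≤ t × Dim S t)

-- Rank-metric codes.  Parameters: base field K (= F_q, q = |K|),
-- extension L (= F_{q^m}) of degree m, length n.

module RankMetric (K L : Field) (q m : ℕ) (E : Extension K L m) where
  private
    module K = Field K
    module L = Field L
  open Extension E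

  LVec : ℕ → VS L
  LVec n = record
    { V = Fin n → L.Carrier
    ; _≈_ = λ u v → ∀ i → u i ≡ v i
    ; _⊕_ = λ u v i → u i L.+ v i
    ; 𝟎 = λ _ → L.0#
    ; _·_ = λ a v i → a L.* v i }

  LoverK : VS K
  LoverK = record
    { V = L.Carrier ; _≈_ = _≡_ ; _⊕_ = L._+_ ; 𝟎 = L.0#
    ; _·_ = λ a x → ι a L.* x }

  Vec : ℕ → Set
  Vec n = Fin n → L.Carrier

  NonZero : ∀ {n} → Vec n → Set
  NonZero v = ¬ (∀ i → v i ≡ L.0#)

  EntrySpan : ∀ {n} → Vec n → L.Carrier → Set
  EntrySpan {n} v x = Σ (Fin n → K.Carrier) λ c → x ≡ lincomb LoverK n c v

  RankWeight : ∀ {n} → Vec n → ℕ → Set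
  RankWeight v r = Dim LoverK (EntrySpan v) r

  IsCode : ∀ n k → (Vec n → Set) → Set
  IsCode n k C = IsSubspace (LVec n) C × Dim (LVec n) C k

  MinRankDistance : ∀ n → (Vec n → Set) → ℕ → Set
  MinRankDistance n C d =
    (∃[ v ] (C v × NonZero v × RankWeight v d)) ×
    (∀ v r → C v → NonZero v → RankWeight v r → d ≤ r)

  IsMRD : ∀ n k → (Vec n → Set) → Set
  IsMRD n k C = ∃[ d ] (MinRankDistance n C d ×
      m ℕ.* k ≡ (m ℕ.* ((n ∸ d) ℕ.+ 1)) ⊓ (n ℕ.* ((m ∸ d) ℕ.+ 1)))

  frob : ∀ {n} → Vec n → Vec n
  frob v i = v i L.^ q

  GaloisClosed : ∀ n → (Vec n → Set) → Set
  GaloisClosed n A = IsSubspace (LVec n) A × (∀ v → A v → A (frob v))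

  _∩_ : ∀ {n} → (Vec n → Set) → (Vec n → Set) → Vec n → Set
  (A ∩ C) v = A v × C v

  GenRankWeight : ∀ n → (Vec n → Set) → ℕ → ℕ → Set₁
  GenRankWeight n C s d =
    (∃[ A ] (GaloisClosed n A × Dim (LVec n) A d × DimGE (LVec n) (A ∩ C) s)) ×
    (∀ A t → GaloisClosed n A → Dim (LVec n) A t → DimGE (LVec n) (A ∩ C) s → d ≤ t)

  IsSMRD : ∀ n k s → (Vec n → Set) → Set₁
  IsSMRD n k s C = GenRankWeight n C s ((n ∸ k) ℕ.+ s)

module Submission where

-- Let β = (β₀, β₁) be a basis of L = F_{q²} over K = F_q and C = {x ⊗ β : x ∈ L^(k+1)},
-- the code of length n = 2(k+1) whose i-th block of two coordinates is (x_i β₀, x_i β₁).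
-- A nonzero codeword has a block with x_i ≠ 0, whose entries span L over K, so d = 2 = m and
-- C is MRD.  The codewords with x₀ = 0 form a k-dimensional subcode lying in the Galois closed
-- space of vectors vanishing on the first block, of dimension 2k < n − (k+1) + k; hence C is not
-- k-MRD.  The proposition is the case k = 2 (an [6,3]_{q²/q} code that is MRD but not 2-MRD).

open import Defs
open import Data.Nat using (ℕ; _≤_; _<_)
open import Data.Product using (Σ; ∃-syntax; _×_)
open import Relation.Nullary using (¬_)

open import Level using (0ℓ)
open import Algebra.Bundles using (CommutativeRing)
import Algebra.Properties.Ring as RingProperties
import Algebra.Properties.CommutativeSemigroup as CommutativeSemigroupProperties
open import Data.Nat as ℕ using (zero; suc; z≤n; s≤s; _∸_; _⊓_)
import Data.Nat.Properties as ℕ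
open import Data.Fin using (Fin; zero; suc; _↑ˡ_; _↑ʳ_; splitAt; join; quotient; remainder; combine)
open import Data.Fin.Properties using (join-splitAt; remQuot-combine)
open import Data.Sum using (inj₁; inj₂)
open import Data.Unit using (⊤; tt)
open import Data.Empty using (⊥-elim)
open import Data.Vec.Functional using (_++_; _∷_; [])
open import Data.Vec.Functional.Properties using (lookup-++ˡ; lookup-++ʳ)
open import Data.Product using (_,_; proj₁; proj₂)
open import Relation.Binary.PropositionalEquality
open import Function using (_∘_)
open import Function.Bundles using (Inverse)

↑-cases : ∀ {b a} {P : Fin (b ℕ.+ a) → Set} →
          (∀ i → P (i ↑ˡ a)) → (∀ i → P (b ↑ʳ i)) → ∀ j → P j
↑-cases {b} {a} {P} P-head P-tail j = subst P (join-splitAt b a j) (P-join (splitAt b j))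
  where
  P-join : ∀ s → P (join b a s)
  P-join (inj₁ i) = P-head i
  P-join (inj₂ i) = P-tail i

¬¬-pull-Fin : ∀ t {P : Fin t → Set} → (∀ i → ¬ ¬ P i) → ¬ ¬ (∀ i → P i)
¬¬-pull-Fin zero    ¬¬P ¬∀P = ¬∀P λ ()
¬¬-pull-Fin (suc t) ¬¬P ¬∀P = ¬¬P zero λ P₀ → ¬¬-pull-Fin t (λ i → ¬¬P (suc i)) λ P₊ →
  ¬∀P λ { zero → P₀ ; (suc i) → P₊ i }

module FieldProperties (F : Field) where
  open Field F public

  commutativeRing : CommutativeRing 0ℓ 0ℓ
  commutativeRing = record { isCommutativeRing = isCommutativeRing }

  open CommutativeRing commutativeRing public
    using (+-identityˡ; +-identityʳ; *-identityˡ; *-identityʳ; zeroˡ; zeroʳ;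
           *-assoc; *-comm; distribʳ)
  open RingProperties (CommutativeRing.ring commutativeRing) public
    using (x+x≈x⇒x≈0)
  open CommutativeSemigroupProperties
         (CommutativeRing.*-commutativeSemigroup commutativeRing) public
    using (x∙yz≈y∙xz)

  *-cancelˡ-≢0 : ∀ {a y z} → ¬ a ≡ 0# → a * y ≡ a * z → y ≡ z
  *-cancelˡ-≢0 {a} {y} {z} a≢0 ay≡az = begin
    y              ≡⟨ sym (*-identityˡ y) ⟩
    1# * y         ≡⟨ cong (_* y) (trans (sym aa⁻¹≡1) (*-comm a a⁻¹)) ⟩
    (a⁻¹ * a) * y  ≡⟨ *-assoc a⁻¹ a y ⟩
    a⁻¹ * (a * y)  ≡⟨ cong (a⁻¹ *_) ay≡az ⟩
    a⁻¹ * (a * z)  ≡⟨ sym (*-assoc a⁻¹ a z) ⟩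
    (a⁻¹ * a) * z  ≡⟨ cong (_* z) (trans (*-comm a⁻¹ a) aa⁻¹≡1) ⟩
    1# * z         ≡⟨ *-identityˡ z ⟩
    z              ∎
    where
    open ≡-Reasoning
    a⁻¹ = proj₁ (inverse a a≢0)
    aa⁻¹≡1 = proj₂ (inverse a a≢0)

  x*y≡0⇒x≡0 : ∀ {x y} → ¬ y ≡ 0# → x * y ≡ 0# → x ≡ 0#
  x*y≡0⇒x≡0 {x} {y} y≢0 xy≡0 =
    *-cancelˡ-≢0 y≢0 (trans (*-comm y x) (trans xy≡0 (sym (zeroʳ y))))

  0^n≡0 : ∀ n → .{{ℕ.NonZero n}} → 0# ^ n ≡ 0#
  0^n≡0 (suc n) = zeroˡ (0# ^ n)

  δ : ∀ {t} → Fin t → Fin t → Carrier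
  δ zero    zero    = 1#
  δ zero    (suc _) = 0#
  δ (suc _) zero    = 0#
  δ (suc i) (suc j) = δ i j

  δ-diagonal : ∀ {t} (i : Fin t) → δ i i ≡ 1#
  δ-diagonal zero    = refl
  δ-diagonal (suc i) = δ-diagonal i

  sumF-cong : ∀ t {f g : Fin t → Carrier} → (∀ i → f i ≡ g i) → sumF t f ≡ sumF t g
  sumF-cong zero    f≗g = refl
  sumF-cong (suc t) f≗g = cong₂ _+_ (f≗g zero) (sumF-cong t (λ i → f≗g (suc i)))

  sumF-0 : ∀ t → sumF t (λ _ → 0#) ≡ 0#
  sumF-0 zero    = refl
  sumF-0 (suc t) = trans (+-identityˡ _) (sumF-0 t)

  sumF-δ : ∀ {t} (i : Fin t) (f : Fin t → Carrier) → sumF t (λ l → δ l i * f l) ≡ f i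
  sumF-δ {suc t} zero f = begin
    1# * f zero + sumF t (λ l → 0# * f (suc l)) ≡⟨ cong₂ _+_ (*-identityˡ _) (sumF-cong t (λ l → zeroˡ _)) ⟩
    f zero + sumF t (λ _ → 0#)                  ≡⟨ cong (f zero +_) (sumF-0 t) ⟩
    f zero + 0#                                 ≡⟨ +-identityʳ _ ⟩
    f zero                                      ∎
    where open ≡-Reasoning
  sumF-δ {suc t} (suc i) f =
    trans (cong (_+ sumF t (λ l → δ l i * f (suc l))) (zeroˡ (f zero)))
          (trans (+-identityˡ _) (sumF-δ i (λ l → f (suc l))))

module _ {F : Field} (W : VS F) where
  open VS W

  Dim-resp : ∀ {S S′ : Pred W} {t} → (∀ v → S v → S′ v) → (∀ v → S′ v → S v) →
             Dim W S t → Dim W S′ t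
  Dim-resp S⊆S′ S′⊆S (b , b∈S , indep , span) =
    b , (λ i → S⊆S′ (b i) (b∈S i)) , indep , (λ v v∈S′ → span v (S′⊆S v v∈S′))

module RankMetricProperties (K L : Field) (q m : ℕ) (E : Extension K L m) where
  open RankMetric K L q m E
  open Extension E
  private
    module K = FieldProperties K
    module L = FieldProperties L
  open L using (_+_; _*_; 0#; 1#)

  ι-0 : ι K.0# ≡ 0#
  ι-0 = L.x+x≈x⇒x≈0 (ι K.0#) (trans (sym (ι-+ K.0# K.0#)) (cong ι (K.+-identityʳ K.0#)))

  ι-0*x≡0 : ∀ x → ι K.0# * x ≡ 0#
  ι-0*x≡0 x = trans (cong (_* x) ι-0) (L.zeroˡ x)

  ι-δ : ∀ {t} (i j : Fin t) → ι (K.δ i j) ≡ L.δ i j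
  ι-δ zero    zero    = ι-1
  ι-δ zero    (suc _) = ι-0
  ι-δ (suc _) zero    = ι-0
  ι-δ (suc i) (suc j) = ι-δ i j

  lincomb-LVec : ∀ {n} t c (b : Fin t → Vec n) j →
                 lincomb (LVec n) t c b j ≡ L.sumF t (λ l → c l * b l j)
  lincomb-LVec zero    c b j = refl
  lincomb-LVec (suc t) c b j =
    cong (c zero * b zero j +_) (lincomb-LVec t (λ l → c (suc l)) (λ l → b (suc l)) j)

  lincomb-LoverK : ∀ t c (b : Fin t → L.Carrier) →
                   lincomb LoverK t c b ≡ L.sumF t (λ l → ι (c l) * b l)
  lincomb-LoverK zero    c b = refl
  lincomb-LoverK (suc t) c b =
    cong (ι (c zero) * b zero +_) (lincomb-LoverK t (λ l → c (suc l)) (λ l → b (suc l)))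

  lincomb-LoverK-0 : ∀ t c (b : Fin t → L.Carrier) → (∀ l → b l ≡ 0#) →
                     lincomb LoverK t c b ≡ 0#
  lincomb-LoverK-0 t c b b≡0 = begin
    lincomb LoverK t c b             ≡⟨ lincomb-LoverK t c b ⟩
    L.sumF t (λ l → ι (c l) * b l)   ≡⟨ L.sumF-cong t (λ l → trans (cong (ι (c l) *_) (b≡0 l)) (L.zeroʳ _)) ⟩
    L.sumF t (λ _ → 0#)              ≡⟨ L.sumF-0 t ⟩
    0#                               ∎
    where open ≡-Reasoning

  lincomb-LoverK-δ : ∀ {t} (i : Fin t) (b : Fin t → L.Carrier) →
                     lincomb LoverK t (λ l → K.δ l i) b ≡ b i
  lincomb-LoverK-δ {t} i b = begin
    lincomb LoverK t (λ l → K.δ l i) b      ≡⟨ lincomb-LoverK t _ b ⟩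
    L.sumF t (λ l → ι (K.δ l i) * b l)      ≡⟨ L.sumF-cong t (λ l → cong (_* b l) (ι-δ l i)) ⟩
    L.sumF t (λ l → L.δ l i * b l)          ≡⟨ L.sumF-δ i b ⟩
    b i                                     ∎
    where open ≡-Reasoning

  entry∈EntrySpan : ∀ {n} (v : Vec n) j → EntrySpan v (v j)
  entry∈EntrySpan v j = (λ l → K.δ l j) , sym (lincomb-LoverK-δ j v)

  basis-linIndep : LinIndep LoverK m basis
  basis-linIndep c Σcb≡0 = unique c (λ _ → K.0#) (begin
    L.sumF m (λ i → ι (c i) * basis i)      ≡⟨ sym (lincomb-LoverK m c basis) ⟩
    lincomb LoverK m c basis                ≡⟨ Σcb≡0 ⟩
    0#                                      ≡⟨ sym (L.sumF-0 m) ⟩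
    L.sumF m (λ _ → 0#)                     ≡⟨ L.sumF-cong m (λ i → sym (ι-0*x≡0 (basis i))) ⟩
    L.sumF m (λ i → ι K.0# * basis i)       ∎)
    where open ≡-Reasoning

  basis≢0 : ∀ i → ¬ basis i ≡ 0#
  basis≢0 i basis-i≡0 = K.0≢1 (sym (begin
    K.1#              ≡⟨ sym (K.δ-diagonal i) ⟩
    K.δ i i           ≡⟨ basis-linIndep (λ l → K.δ l i) (trans (lincomb-LoverK-δ i basis) basis-i≡0) i ⟩
    K.0#              ∎))
    where open ≡-Reasoning

  weight0⇒zero : ∀ {n} (v : Vec n) → RankWeight v 0 → ∀ j → v j ≡ 0#
  weight0⇒zero v (_ , _ , _ , span) j = proj₂ (span (v j) (entry∈EntrySpan v j))

  weight1⇒proportional : ∀ {n} (v : Vec n) → RankWeight v 1 →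
                         ∃[ w ] (∀ j → ∃[ α ] (v j ≡ ι α * w))
  weight1⇒proportional v (w , _ , _ , span) = w zero , λ j →
    let (c , v-j≡) = span (v j) (entry∈EntrySpan v j) in c zero , trans v-j≡ (L.+-identityʳ _)

  Image : ∀ {n t} → ((Fin t → L.Carrier) → Vec n) → Vec n → Set
  Image f v = ∃[ x ] (∀ j → v j ≡ f x j)

  -- At the pivot coordinates, apply reads off the entries of x up to nonzero factors, so its
  -- image has dimension t.
  record MonomialMap (n t : ℕ) : Set where
    field
      position       : Fin n → Fin t
      weight         : Fin n → L.Carrier
      pivot          : Fin t → Fin n
      position-pivot : ∀ i → position (pivot i) ≡ i
      weight-pivot≢0 : ∀ i → ¬ weight (pivot i) ≡ 0#

    apply : (Fin t → L.Carrier) → Vec n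
    apply x j = x (position j) * weight j

    image-isSubspace : IsSubspace (LVec n) (Image apply)
    image-isSubspace = record
      { resp    = λ u≈v (x , u≡x) → x , λ j → trans (sym (u≈v j)) (u≡x j)
      ; has0    = (λ _ → 0#) , λ j → sym (L.zeroˡ (weight j))
      ; closed+ = λ (x , u≡x) (y , v≡y) → (λ i → x i + y i) , λ j →
          trans (cong₂ _+_ (u≡x j) (v≡y j)) (sym (L.distribʳ (weight j) _ _))
      ; closed· = λ a (x , v≡x) → (λ i → a * x i) , λ j →
          trans (cong (a *_) (v≡x j)) (sym (L.*-assoc a _ (weight j)))
      }

    unitImage : Fin t → Vec n
    unitImage i = apply (L.δ i)

    lincomb-unitImage : ∀ c j → lincomb (LVec n) t c unitImage j ≡ apply c j
    lincomb-unitImage c j = begin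
      lincomb (LVec n) t c unitImage j                         ≡⟨ lincomb-LVec t c unitImage j ⟩
      L.sumF t (λ l → c l * (L.δ l (position j) * weight j))   ≡⟨ L.sumF-cong t (λ l → L.x∙yz≈y∙xz (c l) _ _) ⟩
      L.sumF t (λ l → L.δ l (position j) * (c l * weight j))   ≡⟨ L.sumF-δ (position j) (λ l → c l * weight j) ⟩
      apply c j                                                ∎
      where open ≡-Reasoning

    image-dim : Dim (LVec n) (Image apply) t
    image-dim = unitImage , (λ i → L.δ i , λ j → refl) , indep , span
      where
      indep : LinIndep (LVec n) t unitImage
      indep c Σ≡0 i = L.x*y≡0⇒x≡0 (weight-pivot≢0 i) (begin
        c i * weight (pivot i)                   ≡⟨ cong (λ p → c p * weight (pivot i)) (sym (position-pivot i)) ⟩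
        apply c (pivot i)                        ≡⟨ sym (lincomb-unitImage c (pivot i)) ⟩
        lincomb (LVec n) t c unitImage (pivot i) ≡⟨ Σ≡0 (pivot i) ⟩
        0#                                       ∎)
        where open ≡-Reasoning
      span : ∀ v → Image apply v → Σ (Fin t → L.Carrier) λ c → ∀ j → v j ≡ lincomb (LVec n) t c unitImage j
      span v (x , v≡x) = x , λ j → trans (v≡x j) (sym (lincomb-unitImage x j))

  Full : ∀ {n} → Vec n → Set
  Full _ = ⊤

  identityMap : ∀ n → MonomialMap n n
  identityMap n = record
    { position = λ j → j ; weight = λ _ → 1# ; pivot = λ i → i
    ; position-pivot = λ _ → refl ; weight-pivot≢0 = λ _ → L.0≢1 ∘ sym }

  full-dim : ∀ n → Dim (LVec n) Full n
  full-dim n = Dim-resp (LVec n) (λ _ _ → tt)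
    (λ v _ → v , λ j → sym (L.*-identityʳ (v j))) (MonomialMap.image-dim (identityMap n))

  full-isSubspace : ∀ n → IsSubspace (LVec n) Full
  full-isSubspace n = record
    { resp = λ _ _ → tt ; has0 = tt ; closed+ = λ _ _ → tt ; closed· = λ _ _ → tt }

  full-galoisClosed : ∀ n → GaloisClosed n Full
  full-galoisClosed n = full-isSubspace n , λ _ _ → tt

  zeros : ∀ {n} → Vec n
  zeros _ = 0#

  Padded : ∀ b {a} → (Vec a → Set) → Vec (b ℕ.+ a) → Set
  Padded b {a} S v = (∀ i → v (i ↑ˡ a) ≡ 0#) × S (λ j → v (b ↑ʳ j))

  module _ (b : ℕ) {a : ℕ} {S : Vec a → Set} (S-sub : IsSubspace (LVec a) S) where
    private module S = IsSubspace S-sub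

    padded-isSubspace : IsSubspace (LVec (b ℕ.+ a)) (Padded b S)
    padded-isSubspace = record
      { resp    = λ u≈v (u-head≡0 , u-tail∈S) →
          (λ i → trans (sym (u≈v (i ↑ˡ a))) (u-head≡0 i)) , S.resp (λ j → u≈v (b ↑ʳ j)) u-tail∈S
      ; has0    = (λ _ → refl) , S.has0
      ; closed+ = λ (u-head≡0 , u-tail∈S) (v-head≡0 , v-tail∈S) →
          (λ i → trans (cong₂ _+_ (u-head≡0 i) (v-head≡0 i)) (L.+-identityʳ 0#)) , S.closed+ u-tail∈S v-tail∈S
      ; closed· = λ c (v-head≡0 , v-tail∈S) →
          (λ i → trans (cong (c *_) (v-head≡0 i)) (L.zeroʳ c)) , S.closed· c v-tail∈S
      }

    padded-galoisClosed : .{{ℕ.NonZero q}} → GaloisClosed a S → GaloisClosed (b ℕ.+ a) (Padded b S)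
    padded-galoisClosed (_ , S-frob) = padded-isSubspace , λ v (v-head≡0 , v-tail∈S) →
      (λ i → trans (cong (L._^ q) (v-head≡0 i)) (L.0^n≡0 q)) , S-frob _ v-tail∈S

    pad : Vec a → Vec (b ℕ.+ a)
    pad u = zeros {b} ++ u

    pad-head : ∀ u i → pad u (i ↑ˡ a) ≡ 0#
    pad-head u = lookup-++ˡ (zeros {b}) u

    pad-tail : ∀ u i → pad u (b ↑ʳ i) ≡ u i
    pad-tail u = lookup-++ʳ (zeros {b}) u

    lincomb-pad : ∀ t c (e : Fin t → Vec a) →
                  ∀ j → lincomb (LVec (b ℕ.+ a)) t c (pad ∘ e) j ≡ pad (lincomb (LVec a) t c e) j
    lincomb-pad t c e = ↑-cases
      (λ i → begin
        lincomb (LVec (b ℕ.+ a)) t c (pad ∘ e) (i ↑ˡ a)  ≡⟨ lincomb-LVec t c _ (i ↑ˡ a) ⟩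
        L.sumF t (λ l → c l * pad (e l) (i ↑ˡ a))        ≡⟨ L.sumF-cong t (λ l → trans (cong (c l *_) (pad-head (e l) i)) (L.zeroʳ (c l))) ⟩
        L.sumF t (λ _ → 0#)                              ≡⟨ L.sumF-0 t ⟩
        0#                                               ≡⟨ sym (pad-head _ i) ⟩
        pad (lincomb (LVec a) t c e) (i ↑ˡ a)            ∎)
      (λ i → begin
        lincomb (LVec (b ℕ.+ a)) t c (pad ∘ e) (b ↑ʳ i)  ≡⟨ lincomb-LVec t c _ (b ↑ʳ i) ⟩
        L.sumF t (λ l → c l * pad (e l) (b ↑ʳ i))        ≡⟨ L.sumF-cong t (λ l → cong (c l *_) (pad-tail (e l) i)) ⟩
        L.sumF t (λ l → c l * e l i)                     ≡⟨ sym (lincomb-LVec t c e i) ⟩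
        lincomb (LVec a) t c e i                         ≡⟨ sym (pad-tail _ i) ⟩
        pad (lincomb (LVec a) t c e) (b ↑ʳ i)            ∎)
      where open ≡-Reasoning

    padded-dim : ∀ {t} → Dim (LVec a) S t → Dim (LVec (b ℕ.+ a)) (Padded b S) t
    padded-dim {t} (e , e∈S , indep , span) = pad ∘ e , pad-e∈Padded , indep′ , span′
      where
      open ≡-Reasoning
      pad-e∈Padded : ∀ l → Padded b S (pad (e l))
      pad-e∈Padded l = pad-head (e l) , S.resp (λ j → sym (pad-tail (e l) j)) (e∈S l)
      indep′ : LinIndep (LVec (b ℕ.+ a)) t (pad ∘ e)
      indep′ c Σ≡0 = indep c λ j → begin
        lincomb (LVec a) t c e j                          ≡⟨ sym (pad-tail _ j) ⟩
        pad (lincomb (LVec a) t c e) (b ↑ʳ j)             ≡⟨ sym (lincomb-pad t c e (b ↑ʳ j)) ⟩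
        lincomb (LVec (b ℕ.+ a)) t c (pad ∘ e) (b ↑ʳ j)   ≡⟨ Σ≡0 (b ↑ʳ j) ⟩
        0#                                                ∎
      span′ : ∀ v → Padded b S v →
              Σ (Fin t → L.Carrier) λ c → ∀ j → v j ≡ lincomb (LVec (b ℕ.+ a)) t c (pad ∘ e) j
      span′ v (v-head≡0 , v-tail∈S) with span _ v-tail∈S
      ... | c , v-tail≡Σ = c , λ j → trans (v≡pad j) (sym (lincomb-pad t c e j))
        where
        v≡pad : ∀ j → v j ≡ pad (lincomb (LVec a) t c e) j
        v≡pad = ↑-cases (λ i → trans (v-head≡0 i) (sym (pad-head _ i)))
                        (λ i → trans (v-tail≡Σ i) (sym (pad-tail _ i)))

module TensorCodes (K L : Field) (q : ℕ) (E : Extension K L 2) where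
  open RankMetric K L q 2 E
  open RankMetricProperties K L q 2 E
  open Extension E
  private
    module K = FieldProperties K
    module L = FieldProperties L
  open L using (_+_; _*_; 0#; 1#)

  β₀ β₁ : L.Carrier
  β₀ = basis zero
  β₁ = basis (suc zero)

  basis-independent₂ : ∀ {α β} → ι β * β₀ ≡ ι α * β₁ → α ≡ K.0#
  basis-independent₂ {α} {β} βb₀≡αb₁ =
    sym (unique (β ∷ K.0# ∷ []) (K.0# ∷ α ∷ []) (begin
      ι β * β₀ + (ι K.0# * β₁ + 0#)   ≡⟨ cong (ι β * β₀ +_) (trans (L.+-identityʳ _) (ι-0*x≡0 β₁)) ⟩
      ι β * β₀ + 0#                   ≡⟨ L.+-identityʳ _ ⟩
      ι β * β₀                        ≡⟨ βb₀≡αb₁ ⟩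
      ι α * β₁                        ≡⟨ sym (L.+-identityʳ _) ⟩
      ι α * β₁ + 0#                   ≡⟨ sym (L.+-identityˡ _) ⟩
      0# + (ι α * β₁ + 0#)            ≡⟨ cong (_+ (ι α * β₁ + 0#)) (sym (ι-0*x≡0 β₀)) ⟩
      ι K.0# * β₀ + (ι α * β₁ + 0#)   ∎) (suc zero))
    where open ≡-Reasoning

  proportional-pair⇒¬¬0 : ∀ a {α β w} → a * β₀ ≡ ι α * w → a * β₁ ≡ ι β * w → ¬ ¬ a ≡ 0#
  proportional-pair⇒¬¬0 a {α} {β} {w} aβ₀≡αw aβ₁≡βw a≢0 = a≢0 (L.x*y≡0⇒x≡0 (basis≢0 zero) (begin
    a * β₀       ≡⟨ aβ₀≡αw ⟩
    ι α * w      ≡⟨ cong (λ γ → ι γ * w) α≡0 ⟩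
    ι K.0# * w   ≡⟨ ι-0*x≡0 w ⟩
    0#           ∎))
    where
    open ≡-Reasoning
    α≡0 : α ≡ K.0#
    α≡0 = basis-independent₂ (L.*-cancelˡ-≢0 a≢0 (begin
      a * (ι β * β₀)   ≡⟨ L.x∙yz≈y∙xz a (ι β) β₀ ⟩
      ι β * (a * β₀)   ≡⟨ cong (ι β *_) aβ₀≡αw ⟩
      ι β * (ι α * w)  ≡⟨ L.x∙yz≈y∙xz (ι β) (ι α) w ⟩
      ι α * (ι β * w)  ≡⟨ cong (ι α *_) (sym aβ₁≡βw) ⟩
      ι α * (a * β₁)   ≡⟨ L.x∙yz≈y∙xz (ι α) a β₁ ⟩
      a * (ι α * β₁)   ∎))

  tensorMap : ∀ k → MonomialMap (k ℕ.* 2) k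
  tensorMap k = record
    { position       = quotient {k} 2
    ; weight         = basis ∘ remainder {k} 2
    ; pivot          = λ i → combine i zero
    ; position-pivot = λ i → cong proj₁ (remQuot-combine i zero)
    ; weight-pivot≢0 = λ i → basis≢0 zero ∘ trans (cong (basis ∘ proj₂) (sym (remQuot-combine i zero)))
    }

  tensor : ∀ k → (Fin k → L.Carrier) → Vec (k ℕ.* 2)
  tensor k = MonomialMap.apply (tensorMap k)

  TensorCode : ∀ k → Vec (k ℕ.* 2) → Set
  TensorCode k = Image (tensor k)

  tensor-combine : ∀ {k} x (i : Fin k) r → tensor k x (combine i r) ≡ x i * basis r
  tensor-combine x i r = cong (λ (p , s) → x p * basis s) (remQuot-combine i r)

  tensor-isCode : ∀ k → IsCode (k ℕ.* 2) k (TensorCode k)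
  tensor-isCode k = MonomialMap.image-isSubspace (tensorMap k) , MonomialMap.image-dim (tensorMap k)

  -- Equality in L is not decidable, so each x i vanishes only up to double negation; over the
  -- finitely many blocks these combine into ¬ ¬ (x ≡ 0), which contradicts v ≢ 0 all the same.
  tensor-weight≥2 : ∀ k v r → TensorCode k v → NonZero v → RankWeight v r → 2 ≤ r
  tensor-weight≥2 k v zero          _         v≢0 rw = ⊥-elim (v≢0 (weight0⇒zero v rw))
  tensor-weight≥2 k v (suc zero)    (x , v≡x) v≢0 rw = ⊥-elim (¬¬-pull-Fin k x≡0 λ x≡0 →
    v≢0 λ j → trans (v≡x j) (trans (cong (_* _) (x≡0 _)) (L.zeroˡ _)))
    where
    w = proj₁ (weight1⇒proportional v rw)
    proportional = proj₂ (weight1⇒proportional v rw)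
    block : ∀ i r → x i * basis r ≡ ι (proj₁ (proportional (combine i r))) * w
    block i r = trans (sym (trans (v≡x (combine i r)) (tensor-combine x i r))) (proj₂ (proportional (combine i r)))
    x≡0 : ∀ i → ¬ ¬ x i ≡ 0#
    x≡0 i = proportional-pair⇒¬¬0 (x i) (block i zero) (block i (suc zero))
  tensor-weight≥2 k v (suc (suc r)) _         _   _  = s≤s (s≤s z≤n)

  e₀⊗β : ∀ k → Vec (suc k ℕ.* 2)
  e₀⊗β k = tensor (suc k) (L.δ zero)

  e₀⊗β≢0 : ∀ k → NonZero (e₀⊗β k)
  e₀⊗β≢0 k e₀⊗β≡0 = basis≢0 zero (trans (sym (L.*-identityˡ β₀)) (e₀⊗β≡0 zero))

  e₀⊗β-weight : ∀ k → RankWeight (e₀⊗β k) 2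
  e₀⊗β-weight k = basis , basis∈EntrySpan , basis-linIndep , span
    where
    open ≡-Reasoning
    basis∈EntrySpan : ∀ r → EntrySpan (e₀⊗β k) (basis r)
    basis∈EntrySpan r =
      let (c , entry≡) = entry∈EntrySpan (e₀⊗β k) (combine {suc k} zero r)
          basis≡entry = sym (trans (tensor-combine (L.δ zero) zero r) (L.*-identityˡ (basis r)))
      in c , trans basis≡entry entry≡
    span : ∀ y → EntrySpan (e₀⊗β k) y →
           Σ (Fin 2 → K.Carrier) λ c → y ≡ lincomb LoverK 2 c basis
    -- Fin (suc k * 2) is Fin (2 + k * 2), so the combination unfolds into the first block,
    -- whose entries are 1 · β₀ and 1 · β₁, followed by combinations of zeros.
    span y (c , y≡) = (λ r → c (combine {suc k} zero r)) , (begin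
      y                                                         ≡⟨ y≡ ⟩
      ι c₀ * (1# * β₀) + (ι c₁ * (1# * β₁) + rest)              ≡⟨ cong₂ (λ z z′ → ι c₀ * z + (ι c₁ * z′ + rest))
                                                                         (L.*-identityˡ β₀) (L.*-identityˡ β₁) ⟩
      ι c₀ * β₀ + (ι c₁ * β₁ + rest)                            ≡⟨ cong (λ z → ι c₀ * β₀ + (ι c₁ * β₁ + z)) rest≡0 ⟩
      ι c₀ * β₀ + (ι c₁ * β₁ + 0#)                              ∎)
      where
      c₀ = c zero
      c₁ = c (suc zero)
      rest = lincomb LoverK (k ℕ.* 2) (λ j → c (suc (suc j))) (λ j → e₀⊗β k (suc (suc j)))
      rest≡0 : rest ≡ 0#
      rest≡0 = lincomb-LoverK-0 (k ℕ.* 2) _ _ (λ j → L.zeroˡ _)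

  tensor-mrdEquation : ∀ k → 2 ℕ.* suc k ≡ (2 ℕ.* ((suc k ℕ.* 2 ∸ 2) ℕ.+ 1)) ⊓ (suc k ℕ.* 2 ℕ.* ((2 ∸ 2) ℕ.+ 1))
  tensor-mrdEquation k = sym (begin-equality
    (2 ℕ.* (k ℕ.* 2 ℕ.+ 1)) ⊓ (suc k ℕ.* 2 ℕ.* 1)  ≡⟨ ℕ.m≥n⇒m⊓n≡n n≤m ⟩
    suc k ℕ.* 2 ℕ.* 1                             ≡⟨ ℕ.*-identityʳ (suc k ℕ.* 2) ⟩
    suc k ℕ.* 2                                   ≡⟨ ℕ.*-comm (suc k) 2 ⟩
    2 ℕ.* suc k                                   ∎)
    where
    open ℕ.≤-Reasoning
    n≤m : suc k ℕ.* 2 ℕ.* 1 ≤ 2 ℕ.* (k ℕ.* 2 ℕ.+ 1)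
    n≤m = begin
      suc k ℕ.* 2 ℕ.* 1    ≡⟨ trans (ℕ.*-identityʳ (suc k ℕ.* 2)) (ℕ.*-comm (suc k) 2) ⟩
      2 ℕ.* suc k          ≡⟨ cong (2 ℕ.*_) (ℕ.+-comm 1 k) ⟩
      2 ℕ.* (k ℕ.+ 1)      ≤⟨ ℕ.*-monoʳ-≤ 2 (ℕ.+-monoˡ-≤ 1 (ℕ.m≤m*n k 2)) ⟩
      2 ℕ.* (k ℕ.* 2 ℕ.+ 1) ∎

  tensor-isMRD : ∀ k → IsMRD (suc k ℕ.* 2) (suc k) (TensorCode (suc k))
  tensor-isMRD k = 2 , (e₀⊗β∈C , tensor-weight≥2 (suc k)) , tensor-mrdEquation k
    where
    e₀⊗β∈C = e₀⊗β k , (L.δ zero , λ _ → refl) , e₀⊗β≢0 k , e₀⊗β-weight k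

  ZeroFirstBlock : ∀ k → Vec (suc k ℕ.* 2) → Set
  ZeroFirstBlock k = Padded 2 Full

  -- Since 2 ↑ʳ j = suc (suc j), on which quotient and remainder reduce, the tail of x ⊗ β is
  -- (x ∘ suc) ⊗ β definitionally.
  zeroFirstBlock∩tensor⇒padded : ∀ k v → (ZeroFirstBlock k ∩ TensorCode (suc k)) v → Padded 2 (TensorCode k) v
  zeroFirstBlock∩tensor⇒padded k v ((v-head≡0 , _) , x , v≡x) = v-head≡0 , (λ i → x (suc i)) , λ j → v≡x (suc (suc j))

  padded⇒zeroFirstBlock∩tensor : ∀ k v → Padded 2 (TensorCode k) v → (ZeroFirstBlock k ∩ TensorCode (suc k)) v
  padded⇒zeroFirstBlock∩tensor k v (v-head≡0 , y , v-tail≡y) = (v-head≡0 , tt) , (0# ∷ y) , λ where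
    zero             → trans (v-head≡0 zero) (sym (L.zeroˡ β₀))
    (suc zero)       → trans (v-head≡0 (suc zero)) (sym (L.zeroˡ β₁))
    (suc (suc j))    → v-tail≡y j

  tensor-not-SMRD : .{{ℕ.NonZero q}} → ∀ k → ¬ IsSMRD (suc k ℕ.* 2) (suc k) k (TensorCode (suc k))
  tensor-not-SMRD k (_ , minimal) = ℕ.n≮n (k ℕ.* 2) (subst (_≤ k ℕ.* 2) d+k≡ d≤)
    where
    A-galoisClosed : GaloisClosed (suc k ℕ.* 2) (ZeroFirstBlock k)
    A-galoisClosed = padded-galoisClosed 2 (full-isSubspace (k ℕ.* 2)) (full-galoisClosed (k ℕ.* 2))
    A-dim : Dim (LVec (suc k ℕ.* 2)) (ZeroFirstBlock k) (k ℕ.* 2)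
    A-dim = padded-dim 2 (full-isSubspace (k ℕ.* 2)) (full-dim (k ℕ.* 2))
    A∩C-dim : Dim (LVec (suc k ℕ.* 2)) (ZeroFirstBlock k ∩ TensorCode (suc k)) k
    A∩C-dim = Dim-resp (LVec (suc k ℕ.* 2)) (padded⇒zeroFirstBlock∩tensor k) (zeroFirstBlock∩tensor⇒padded k)
                (padded-dim 2 (proj₁ (tensor-isCode k)) (proj₂ (tensor-isCode k)))
    d≤ : (suc k ℕ.* 2 ∸ suc k) ℕ.+ k ≤ k ℕ.* 2
    d≤ = minimal (ZeroFirstBlock k) (k ℕ.* 2) A-galoisClosed A-dim (k , ℕ.≤-refl , A∩C-dim)
    d+k≡ : (suc k ℕ.* 2 ∸ suc k) ℕ.+ k ≡ suc (k ℕ.* 2)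
    d+k≡ = ℕ.m∸n+n≡m (ℕ.≤-trans (ℕ.m≤m*n k 2) (ℕ.n≤1+n (k ℕ.* 2)))

proposition5p10 : (K : Field) (q : ℕ) → HasSize K q →
  ∃[ n ] ∃[ k ] ∃[ m ] (0 < n × 2 ≤ k × 0 < m ×
    ((L : Field) (E : Extension K L m) →
      Σ (RankMetric.Vec K L q m E n → Set) λ C → (RankMetric.IsCode K L q m E n k C ×
              RankMetric.IsMRD K L q m E n k C ×
              ¬ RankMetric.IsSMRD K L q m E n k 2 C)))
proposition5p10 K zero    K↔Fin0 with Inverse.to K↔Fin0 (Field.0# K)
... | ()
proposition5p10 K (suc q) _ = 6 , 3 , 2 , s≤s z≤n , s≤s (s≤s z≤n) , s≤s z≤n , λ L E →
  let open TensorCodes K L (suc q) E in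
  TensorCode 3 , tensor-isCode 3 , tensor-isMRD 2 , tensor-not-SMRD 2
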